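{- Let $G$ be a connected graph of order $n$, $x$ a cut-vertex of $G$ such that $G-x$ has $M\geq 3$ connected components $G_1,\dots,G_M$, of orders $n_1,\dots,n_M$, indexed so that $N_M=\min\{N_i:1\leq i\leq M\}$. Let $G'$ be the subgraph induced by $\{x\}\cup\bigcup_{i=1}^{M-1}V(G_i)$, of order $n'=n-n_M$. If \[(n'-1)\prod_{i=1}^{M-1}N_i(x) > 2\sum_{i=1}^{M-1}(n'-n_i)N_i,\] then \[(n-1)\prod_{i=1}^{M}N_i(x) > 2\sum_{i=1}^{M}(n-n_i)N_i.\]
   Context: A set of vertices is a connected set if it induces a connected subgraph. $G'_i$ is the subgraph of $G$ induced by $V(G_i)\cup\{x\}$; $N_i$ is the number of nonempty connected sets of $G_i$ and $N_i(x)$ is the number of connected sets of $G'_i$ containing $x$. -}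

module Defs where

open import Data.Nat using (ℕ; zero; suc; _+_; _*_; _∸_; _≤_; _<_)
open import Data.Fin using (Fin; zero; suc; fromℕ; inject₁)
open import Data.Fin.Subset using (Subset; _∈_; _∉_; _⊆_; ∣_∣; Nonempty; ⊤; _∪_; ⁅_⁆)
open import Data.List using (List; length)
open import Data.List.Relation.Unary.Unique.Propositional using (Unique)
import Data.List.Membership.Propositional as LM
open import Data.Product using (Σ; _×_; ∃; ∃-syntax)
open import Relation.Binary.PropositionalEquality using (_≡_; _≢_)
open import Relation.Nullary using (¬_)
open import Function.Bundles using (_⇔_)

record Graph (n : ℕ) : Set₁ where
  field
    Adj     : Fin n → Fin n → Set
    sym     : ∀ {u v} → Adj u v → Adj v u
    irrefl  : ∀ {u} → ¬ Adj u u
open Graph public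

data Walk {n : ℕ} (G : Graph n) (S : Subset n) : Fin n → Fin n → Set where
  stay : ∀ {u} → u ∈ S → Walk G S u u
  step : ∀ {u w v} → u ∈ S → Adj G u w → Walk G S w v → Walk G S u v

InducesConnected : ∀ {n} → Graph n → Subset n → Set
InducesConnected G S = ∀ u v → u ∈ S → v ∈ S → Walk G S u v

ConnectedSet : ∀ {n} → Graph n → Subset n → Set
ConnectedSet G S = Nonempty S × InducesConnected G S

IsConnectedGraph : ∀ {n} → Graph n → Set
IsConnectedGraph G = InducesConnected G ⊤

HasSize : ∀ {n} → (Subset n → Set) → ℕ → Set
HasSize {n} P k = Σ (List (Subset n)) λ L →
  Unique L × (∀ S → (S LM.∈ L) ⇔ P S) × length L ≡ k

-- V : Fin M → Subset n are the vertex sets of the connected components of G - x.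
IsComponentsOfDeletion : ∀ {n M} → Graph n → Fin n → (Fin M → Subset n) → Set
IsComponentsOfDeletion {n} {M} G x V =
  (∀ i → x ∉ V i) ×
  (∀ v → v ≢ x → ∃[ i ] v ∈ V i) ×
  (∀ i j v → v ∈ V i → v ∈ V j → i ≡ j) ×
  (∀ i → ConnectedSet G (V i)) ×
  (∀ i j u v → u ∈ V i → v ∈ V j → Adj G u v → i ≡ j)

∑ : ∀ k → (Fin k → ℕ) → ℕ
∑ zero    f = 0
∑ (suc k) f = f zero + ∑ k (λ i → f (suc i))

∏ : ∀ k → (Fin k → ℕ) → ℕ
∏ zero    f = 1
∏ (suc k) f = f zero * ∏ k (λ i → f (suc i))

module Submission where

-- Put n′ = n − n_M, e = n′ − 1 and S = Σ_{i<M} (n′ − n_i) N_i. The components other than G_M, with x,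
-- fill n′ vertices, so every weight n′ − n_i is positive and the first two weights add up to at least e + 2;
-- since N_M is the least N_i this gives Σ_{i<M} N_i + e N_M ≤ S. Passing from G′ to G raises every
-- weight by n_M and adds the term n′ N_M, while the product gains the factor N_M(x) ≥ n_M + 1: growing
-- {x} one neighbour at a time inside V(G_M) ∪ {x} gives n_M + 1 distinct connected sets through x.
-- These estimates turn the hypothesis 2S < e ∏_{i<M} N_i(x) into the claim.

open import Defs hiding (sym)
open import Data.Nat using (ℕ; zero; suc; _+_; _*_; _∸_; _≤_; _<_; z≤n; s≤s)
open import Data.Nat.Properties hiding (_≟_)
open import Data.Nat.Tactic.RingSolver using (solve-∀)
open import Data.Fin using (Fin; zero; suc; fromℕ; inject₁; _≟_)
open import Data.Fin.Properties using (any?; fromℕ≢inject₁)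
open import Data.Fin.Subset using (Subset; _∈_; _∉_; _⊆_; ∣_∣; _∪_; ⁅_⁆; Nonempty; inside; outside)
open import Data.Fin.Subset.Properties
  using (_∈?_; ∈⊤; ∉⊥; ⊆⊤; ⊆-min; ⊆-refl; ⊆-trans; p⊆p∪q; q⊆p∪q; x∈p∪q⁻; x∈⁅x⁆; x∈⁅y⁆⇒x≡y;
         ∣⊥∣≡0; ∣⊤∣≡n; ∣⁅x⁆∣≡1; ∣p∣≤n; p⊆q⇒∣p∣≤∣q∣; p⊂q⇒∣p∣<∣q∣)
open import Data.Vec using ([]; _∷_; here; there)
open import Data.List using (List; []; _∷_; length; _++_)
open import Data.List.Properties using (length-++)
open import Data.List.Relation.Unary.All as All using (All; []; _∷_)
open import Data.List.Relation.Unary.AllPairs using ([]; _∷_)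
open import Data.List.Relation.Unary.Any using (here; there)
open import Data.List.Relation.Unary.Unique.Propositional using (Unique)
import Data.List.Membership.Propositional as List
open import Data.List.Membership.Propositional.Properties using (∈-∃++; ∈-++⁻; ∈-++⁺ˡ; ∈-++⁺ʳ)
open import Data.Product using (Σ; ∃; ∃₂; _×_; _,_; proj₁; proj₂)
open import Data.Sum using (inj₁; inj₂)
open import Function.Bundles using (Equivalence)
open import Relation.Nullary using (yes; no; ¬?; contradiction)
open import Relation.Nullary.Decidable using (_×-dec_; decidable-stable)
open import Relation.Binary.PropositionalEquality
  using (_≡_; _≢_; refl; sym; trans; cong; subst; module ≡-Reasoning)

Disjoint : ∀ {n} → Subset n → Subset n → Set
Disjoint p q = ∀ {v} → v ∈ p → v ∉ q

Disjoint-∪ʳ : ∀ {n} {r : Subset n} p q → Disjoint r p → Disjoint r q → Disjoint r (p ∪ q)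
Disjoint-∪ʳ p q r#p r#q v∈r v∈p∪q with x∈p∪q⁻ p q v∈p∪q
... | inj₁ v∈p = r#p v∈r v∈p
... | inj₂ v∈q = r#q v∈r v∈q

Disjoint-tail : ∀ {n s t} {p q : Subset n} → Disjoint (s ∷ p) (t ∷ q) → Disjoint p q
Disjoint-tail p#q v∈p v∈q = p#q (there v∈p) (there v∈q)

x∉p⇒Disjoint[p,⁅x⁆] : ∀ {n x} {p : Subset n} → x ∉ p → Disjoint p ⁅ x ⁆
x∉p⇒Disjoint[p,⁅x⁆] {x = x} {p} x∉p v∈p v∈⁅x⁆ = x∉p (subst (_∈ p) (x∈⁅y⁆⇒x≡y x v∈⁅x⁆) v∈p)

∣p∪q∣≡∣p∣+∣q∣ : ∀ {n} (p q : Subset n) → Disjoint p q → ∣ p ∪ q ∣ ≡ ∣ p ∣ + ∣ q ∣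
∣p∪q∣≡∣p∣+∣q∣ []            []            p#q = refl
∣p∪q∣≡∣p∣+∣q∣ (inside  ∷ p) (inside  ∷ q) p#q = contradiction here (p#q here)
∣p∪q∣≡∣p∣+∣q∣ (inside  ∷ p) (outside ∷ q) p#q = cong suc (∣p∪q∣≡∣p∣+∣q∣ p q (Disjoint-tail p#q))
∣p∪q∣≡∣p∣+∣q∣ (outside ∷ p) (inside  ∷ q) p#q =
  trans (cong suc (∣p∪q∣≡∣p∣+∣q∣ p q (Disjoint-tail p#q))) (sym (+-suc ∣ p ∣ ∣ q ∣))
∣p∪q∣≡∣p∣+∣q∣ (outside ∷ p) (outside ∷ q) p#q = ∣p∪q∣≡∣p∣+∣q∣ p q (Disjoint-tail p#q)

Nonempty⇒0<∣p∣ : ∀ {n} {p : Subset n} → Nonempty p → 0 < ∣ p ∣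
Nonempty⇒0<∣p∣ {n} {p} (v , v∈p) = subst (_< ∣ p ∣) (∣⊥∣≡0 n) (p⊂q⇒∣p∣<∣q∣ (⊆-min p , v , v∈p , ∉⊥))

x∉p⇒∣p∣<n : ∀ {n x} {p : Subset n} → x ∉ p → ∣ p ∣ < n
x∉p⇒∣p∣<n {n} {x} {p} x∉p = subst (∣ p ∣ <_) (∣⊤∣≡n n) (p⊂q⇒∣p∣<∣q∣ (⊆⊤ , x , ∈⊤ , x∉p))

∣p∣<∣q∣⇒∃q∖p : ∀ {n} {p q : Subset n} → ∣ p ∣ < ∣ q ∣ → ∃ λ v → v ∈ q × v ∉ p
∣p∣<∣q∣⇒∃q∖p {p = p} {q} ∣p∣<∣q∣ with any? (λ v → v ∈? q ×-dec ¬? (v ∈? p))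
... | yes q∖p∋v = q∖p∋v
... | no q∖p≡∅  = contradiction (p⊆q⇒∣p∣≤∣q∣ q⊆p) (<⇒≱ ∣p∣<∣q∣)
  where
  q⊆p : q ⊆ p
  q⊆p {v} v∈q = decidable-stable (v ∈? p) (λ v∉p → q∖p≡∅ (v , v∈q , v∉p))

∈-++-remove : ∀ {A : Set} {a b : A} ys zs → b List.∈ ys ++ a ∷ zs → b ≢ a → b List.∈ ys ++ zs
∈-++-remove ys zs b∈ b≢a with ∈-++⁻ ys b∈
... | inj₁ b∈ys          = ∈-++⁺ˡ b∈ys
... | inj₂ (here b≡a)    = contradiction b≡a b≢a
... | inj₂ (there b∈zs)  = ∈-++⁺ʳ ys b∈zs

Unique⇒length≤ : ∀ {A : Set} {xs ys : List A} → Unique xs → (∀ {a} → a List.∈ xs → a List.∈ ys) →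
  length xs ≤ length ys
Unique⇒length≤ {xs = []}     _              _     = z≤n
Unique⇒length≤ {xs = a ∷ xs} (a∉xs ∷ uxs) xs⊆ys with ∈-∃++ (xs⊆ys (here refl))
... | ys , zs , refl = begin
  suc (length xs)           ≤⟨ s≤s (Unique⇒length≤ uxs (λ b∈xs → ∈-++-remove ys zs (xs⊆ys (there b∈xs)) (b≢a b∈xs))) ⟩
  suc (length (ys ++ zs))   ≡⟨ cong suc (length-++ ys) ⟩
  suc (length ys + length zs) ≡⟨ sym (+-suc (length ys) (length zs)) ⟩
  length ys + length (a ∷ zs) ≡⟨ sym (length-++ ys) ⟩
  length (ys ++ a ∷ zs)     ∎
  where
  open ≤-Reasoning
  b≢a : ∀ {b} → b List.∈ xs → b ≢ a
  b≢a b∈xs b≡a = All.lookup a∉xs b∈xs (sym b≡a)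

length≤HasSize : ∀ {n} {P : Subset n → Set} {k} → HasSize P k → ∀ {L} → Unique L → All P L → length L ≤ k
length≤HasSize (_ , _ , ∈⇔P , refl) uL PL = Unique⇒length≤ uL (λ S∈L → Equivalence.from (∈⇔P _) (All.lookup PL S∈L))

module _ {n : ℕ} (G : Graph n) where

  Walk-mono : ∀ {A B u v} → A ⊆ B → Walk G A u v → Walk G B u v
  Walk-mono A⊆B (stay u∈A)       = stay (A⊆B u∈A)
  Walk-mono A⊆B (step u∈A u~w w) = step (A⊆B u∈A) u~w (Walk-mono A⊆B w)

  Walk-source : ∀ {A u v} → Walk G A u v → u ∈ A
  Walk-source (stay u∈A)     = u∈A
  Walk-source (step u∈A _ _) = u∈A

  Walk-++ : ∀ {A u v w} → Walk G A u v → Walk G A v w → Walk G A u w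
  Walk-++ (stay _)          q = q
  Walk-++ (step u∈A u~u′ p) q = step u∈A u~u′ (Walk-++ p q)

  Walk-exit : ∀ {A T a b} → Walk G A a b → a ∈ T → b ∉ T →
    ∃₂ λ u w → u ∈ T × w ∉ T × w ∈ A × Adj G u w
  Walk-exit (stay _) a∈T b∉T = contradiction a∈T b∉T
  Walk-exit {T = T} (step {w = w} _ a~w p) a∈T b∉T with w ∈? T
  ... | yes w∈T = Walk-exit p w∈T b∉T
  ... | no  w∉T = _ , w , a∈T , w∉T , Walk-source p , a~w

  connected-∪-neighbour : ∀ {T u w} → InducesConnected G T → u ∈ T → Adj G u w →
    InducesConnected G (T ∪ ⁅ w ⁆)
  connected-∪-neighbour {T} {u} {w} T-conn u∈T u~w a b a∈T′ b∈T′ = Walk-++ (to-u a∈T′) (from-u b∈T′)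
    where
    T⊆T′ : T ⊆ T ∪ ⁅ w ⁆
    T⊆T′ = p⊆p∪q ⁅ w ⁆
    w∈T′ : w ∈ T ∪ ⁅ w ⁆
    w∈T′ = q⊆p∪q T ⁅ w ⁆ (x∈⁅x⁆ w)
    to-u : ∀ {a} → a ∈ T ∪ ⁅ w ⁆ → Walk G (T ∪ ⁅ w ⁆) a u
    to-u {a} a∈T′ with x∈p∪q⁻ T ⁅ w ⁆ a∈T′
    ... | inj₁ a∈T   = Walk-mono T⊆T′ (T-conn a u a∈T u∈T)
    ... | inj₂ a∈⁅w⁆ rewrite x∈⁅y⁆⇒x≡y w a∈⁅w⁆ = step w∈T′ (Graph.sym G u~w) (stay (T⊆T′ u∈T))
    from-u : ∀ {b} → b ∈ T ∪ ⁅ w ⁆ → Walk G (T ∪ ⁅ w ⁆) u b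
    from-u {b} b∈T′ with x∈p∪q⁻ T ⁅ w ⁆ b∈T′
    ... | inj₁ b∈T   = Walk-mono T⊆T′ (T-conn u b u∈T b∈T)
    ... | inj₂ b∈⁅w⁆ rewrite x∈⁅y⁆⇒x≡y w b∈⁅w⁆ = step (T⊆T′ u∈T) u~w (stay w∈T′)

  connected-⁅x⁆ : ∀ x → InducesConnected G ⁅ x ⁆
  connected-⁅x⁆ x a b a∈ b∈ rewrite x∈⁅y⁆⇒x≡y x a∈ | x∈⁅y⁆⇒x≡y x b∈ = stay (x∈⁅x⁆ x)

  connected-grow : ∀ {S T} → InducesConnected G S → InducesConnected G T → T ⊆ S → Nonempty T → ∣ T ∣ < ∣ S ∣ →
    ∃ λ w → w ∈ S × w ∉ T × InducesConnected G (T ∪ ⁅ w ⁆)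
  connected-grow S-conn T-conn T⊆S (t , t∈T) ∣T∣<∣S∣ with ∣p∣<∣q∣⇒∃q∖p ∣T∣<∣S∣
  ... | v , v∈S , v∉T with Walk-exit (S-conn t v (T⊆S t∈T) v∈S) t∈T v∉T
  ... | u , w , u∈T , w∉T , w∈S , u~w = w , w∈S , w∉T , connected-∪-neighbour T-conn u∈T u~w

  ConnectedSetThrough : Fin n → Subset n → Subset n → Set
  ConnectedSetThrough x S U = ConnectedSet G U × x ∈ U × U ⊆ S

  connected-chain : ∀ {S x} → InducesConnected G S → ∀ m {T} →
    InducesConnected G T → x ∈ T → T ⊆ S → ∣ T ∣ + m ≡ ∣ S ∣ →
    Σ (List (Subset n)) λ L →
      Unique L × All (ConnectedSetThrough x S) L × All (T ⊆_) L × length L ≡ suc m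
  connected-chain S-conn zero {T} T-conn x∈T T⊆S _ =
    T ∷ [] , [] ∷ [] , (((_ , x∈T) , T-conn) , x∈T , T⊆S) ∷ [] , ⊆-refl ∷ [] , refl
  connected-chain {S} {x} S-conn (suc m) {T} T-conn x∈T T⊆S ∣T∣+1+m≡∣S∣ =
    extend (connected-grow S-conn T-conn T⊆S (x , x∈T) ∣T∣<∣S∣)
    where
    ∣T∣<∣S∣ : ∣ T ∣ < ∣ S ∣
    ∣T∣<∣S∣ = subst (∣ T ∣ <_) ∣T∣+1+m≡∣S∣ (m<m+n ∣ T ∣ (s≤s z≤n))
    extend : (∃ λ w → w ∈ S × w ∉ T × InducesConnected G (T ∪ ⁅ w ⁆)) →
      Σ (List (Subset n)) λ L →
        Unique L × All (ConnectedSetThrough x S) L × All (T ⊆_) L × length L ≡ suc (suc m)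
    extend (w , w∈S , w∉T , T′-conn) =
      let L , uL , PL , T′⊆L , ∣L∣≡ = connected-chain S-conn m T′-conn (T⊆T′ x∈T) T′⊆S ∣T′∣+m≡∣S∣ in
      T ∷ L , All.map T≢ T′⊆L ∷ uL , (((_ , x∈T) , T-conn) , x∈T , T⊆S) ∷ PL ,
      ⊆-refl ∷ All.map (⊆-trans T⊆T′) T′⊆L , cong suc ∣L∣≡
      where
      T⊆T′ : T ⊆ T ∪ ⁅ w ⁆
      T⊆T′ = p⊆p∪q ⁅ w ⁆
      T′⊆S : T ∪ ⁅ w ⁆ ⊆ S
      T′⊆S v∈T′ with x∈p∪q⁻ T ⁅ w ⁆ v∈T′
      ... | inj₁ v∈T   = T⊆S v∈T
      ... | inj₂ v∈⁅w⁆ = subst (_∈ S) (sym (x∈⁅y⁆⇒x≡y w v∈⁅w⁆)) w∈S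
      ∣T′∣+m≡∣S∣ : ∣ T ∪ ⁅ w ⁆ ∣ + m ≡ ∣ S ∣
      ∣T′∣+m≡∣S∣ = begin
        ∣ T ∪ ⁅ w ⁆ ∣ + m     ≡⟨ cong (_+ m) (∣p∪q∣≡∣p∣+∣q∣ T ⁅ w ⁆ (x∉p⇒Disjoint[p,⁅x⁆] w∉T)) ⟩
        ∣ T ∣ + ∣ ⁅ w ⁆ ∣ + m ≡⟨ cong (λ k → ∣ T ∣ + k + m) (∣⁅x⁆∣≡1 w) ⟩
        ∣ T ∣ + 1 + m         ≡⟨ +-assoc ∣ T ∣ 1 m ⟩
        ∣ T ∣ + suc m         ≡⟨ ∣T∣+1+m≡∣S∣ ⟩
        ∣ S ∣                 ∎
        where open ≡-Reasoning
      T≢ : ∀ {U} → T ∪ ⁅ w ⁆ ⊆ U → T ≢ U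
      T≢ T′⊆U refl = w∉T (T′⊆U (q⊆p∪q T ⁅ w ⁆ (x∈⁅x⁆ w)))

  ∣S∣≤#connectedSetsThrough : ∀ {S x k} → InducesConnected G S → x ∈ S →
    HasSize (ConnectedSetThrough x S) k → ∣ S ∣ ≤ k
  ∣S∣≤#connectedSetsThrough {S} {x} S-conn x∈S count =
    let L , uL , PL , _ , ∣L∣≡ =
          connected-chain S-conn (∣ S ∣ ∸ 1) (connected-⁅x⁆ x) (x∈⁅x⁆ x) ⁅x⁆⊆S ∣⁅x⁆∣+∣S∣∸1≡∣S∣ in
    subst (_≤ _) (trans ∣L∣≡ (m+[n∸m]≡n 0<∣S∣)) (length≤HasSize count uL PL)
    where
    0<∣S∣ : 0 < ∣ S ∣
    0<∣S∣ = Nonempty⇒0<∣p∣ (x , x∈S)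
    ⁅x⁆⊆S : ⁅ x ⁆ ⊆ S
    ⁅x⁆⊆S v∈⁅x⁆ = subst (_∈ S) (sym (x∈⁅y⁆⇒x≡y x v∈⁅x⁆)) x∈S
    ∣⁅x⁆∣+∣S∣∸1≡∣S∣ : ∣ ⁅ x ⁆ ∣ + (∣ S ∣ ∸ 1) ≡ ∣ S ∣
    ∣⁅x⁆∣+∣S∣∸1≡∣S∣ = trans (cong (_+ (∣ S ∣ ∸ 1)) (∣⁅x⁆∣≡1 x)) (m+[n∸m]≡n 0<∣S∣)

m∸a≤m∸b∸a+b : ∀ m a b → m ∸ a ≤ m ∸ b ∸ a + b
m∸a≤m∸b∸a+b m a b = begin
  m ∸ a             ≤⟨ m≤n+m∸n (m ∸ a) b ⟩
  b + (m ∸ a ∸ b)   ≡⟨ cong (b +_) (∸-+-assoc m a b) ⟩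
  b + (m ∸ (a + b)) ≡⟨ cong (λ c → b + (m ∸ c)) (+-comm a b) ⟩
  b + (m ∸ (b + a)) ≡⟨ cong (b +_) (∸-+-assoc m b a) ⟨
  b + (m ∸ b ∸ a)   ≡⟨ +-comm b _ ⟩
  m ∸ b ∸ a + b     ∎
  where open ≤-Reasoning

∑-last : ∀ k (f : Fin (suc k) → ℕ) → ∑ (suc k) f ≡ ∑ k (λ i → f (inject₁ i)) + f (fromℕ k)
∑-last zero    f = +-identityʳ (f zero)
∑-last (suc k) f = trans (cong (f zero +_) (∑-last k (λ i → f (suc i)))) (sym (+-assoc (f zero) _ _))

∏-last : ∀ k (f : Fin (suc k) → ℕ) → ∏ (suc k) f ≡ ∏ k (λ i → f (inject₁ i)) * f (fromℕ k)
∏-last zero    f = trans (*-identityʳ (f zero)) (sym (+-identityʳ (f zero)))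
∏-last (suc k) f = trans (cong (f zero *_) (∏-last k (λ i → f (suc i)))) (sym (*-assoc (f zero) _ _))

∑-mono-≤ : ∀ k {f g : Fin k → ℕ} → (∀ i → f i ≤ g i) → ∑ k f ≤ ∑ k g
∑-mono-≤ zero    f≤g = z≤n
∑-mono-≤ (suc k) f≤g = +-mono-≤ (f≤g zero) (∑-mono-≤ k (λ i → f≤g (suc i)))

∑-+-* : ∀ k c (f g : Fin k → ℕ) → ∑ k (λ i → f i + c * g i) ≡ ∑ k f + c * ∑ k g
∑-+-* zero    c f g = sym (cong (0 +_) (*-zeroʳ c))
∑-+-* (suc k) c f g = begin
  f zero + c * g zero + ∑ k (λ i → f (suc i) + c * g (suc i))
    ≡⟨ cong (f zero + c * g zero +_) (∑-+-* k c (λ i → f (suc i)) (λ i → g (suc i))) ⟩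
  f zero + c * g zero + (∑ k (λ i → f (suc i)) + c * ∑ k (λ i → g (suc i)))
    ≡⟨ interchange (f zero) (g zero) (∑ k (λ i → f (suc i))) (∑ k (λ i → g (suc i))) c ⟩
  f zero + ∑ k (λ i → f (suc i)) + c * (g zero + ∑ k (λ i → g (suc i))) ∎
  where
  open ≡-Reasoning
  interchange : ∀ a b s t c → a + c * b + (s + c * t) ≡ a + s + c * (b + t)
  interchange = solve-∀

∑-weights-∸ : ∀ k n m (s N : Fin k → ℕ) →
  ∑ k (λ i → (n ∸ s i) * N i) ≤ ∑ k (λ i → (n ∸ m ∸ s i) * N i) + m * ∑ k N
∑-weights-∸ k n m s N = ≤-trans (∑-mono-≤ k term) (≤-reflexive (∑-+-* k m (λ i → (n ∸ m ∸ s i) * N i) N))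
  where
  open ≤-Reasoning
  term : ∀ i → (n ∸ s i) * N i ≤ (n ∸ m ∸ s i) * N i + m * N i
  term i = begin
    (n ∸ s i) * N i             ≤⟨ *-monoˡ-≤ (N i) (m∸a≤m∸b∸a+b n (s i) m) ⟩
    (n ∸ m ∸ s i + m) * N i     ≡⟨ *-distribʳ-+ (N i) (n ∸ m ∸ s i) m ⟩
    (n ∸ m ∸ s i) * N i + m * N i ∎

∑-excess : ∀ k (s N : Fin (suc (suc k)) → ℕ) {e L} →
  (∀ i → s i ≤ e) → s zero + s (suc zero) ≤ e → (∀ i → L ≤ N i) →
  ∑ (suc (suc k)) N + e * L ≤ ∑ (suc (suc k)) (λ i → (suc e ∸ s i) * N i)
∑-excess k s N {e} {L} s≤e s₀+s₁≤e L≤N = begin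
  ∑ K N + e * L              ≤⟨ +-monoʳ-≤ (∑ K N) (*-monoˡ-≤ L e≤∑w) ⟩
  ∑ K N + ∑ K w * L          ≡⟨ cong (∑ K N +_) (*-comm (∑ K w) L) ⟩
  ∑ K N + L * ∑ K w          ≡⟨ sym (∑-+-* K L N w) ⟩
  ∑ K (λ i → N i + L * w i)  ≤⟨ ∑-mono-≤ K term ⟩
  ∑ K (λ i → (suc e ∸ s i) * N i) ∎
  where
  open ≤-Reasoning
  K : ℕ
  K = suc (suc k)
  w : Fin K → ℕ
  w i = e ∸ s i
  e≤∑w : e ≤ ∑ K w
  e≤∑w = begin
    e                     ≡⟨ sym (m+[n∸m]≡n (s≤e (suc zero))) ⟩
    s (suc zero) + w (suc zero)
      ≤⟨ +-monoˡ-≤ (w (suc zero)) (m+n≤o⇒m≤o∸n (s (suc zero)) (subst (_≤ e) (+-comm (s zero) _) s₀+s₁≤e)) ⟩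
    w zero + w (suc zero) ≤⟨ +-monoʳ-≤ (w zero) (m≤m+n (w (suc zero)) _) ⟩
    ∑ K w                 ∎
  term : ∀ i → N i + L * w i ≤ (suc e ∸ s i) * N i
  term i = begin
    N i + L * w i    ≡⟨ cong (N i +_) (*-comm L (w i)) ⟩
    N i + w i * L    ≤⟨ +-monoʳ-≤ (N i) (*-monoʳ-≤ (w i) (L≤N i)) ⟩
    suc (w i) * N i  ≡⟨ cong (_* N i) (sym (+-∸-assoc 1 (s≤e i))) ⟩
    (suc e ∸ s i) * N i ∎

add-component-inequality : ∀ {S T D L P c} e m →
  T + e * L ≤ S → 2 * S < e * P → D ≤ S + m * T → 1 ≤ m → suc m ≤ c →
  2 * (D + suc e * L) < (e + m) * (P * c)
add-component-inequality {S} {T} {D} {L} {P} {c} e (suc k) excess hyp D≤ _ m<c = begin-strict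
  2 * (D + suc e * L)                        ≤⟨ *-monoʳ-≤ 2 (+-monoˡ-≤ (suc e * L) D≤) ⟩
  2 * (S + suc k * T + suc e * L)            ≡⟨ regroup S T L k e ⟩
  2 * S + 2 * (T + e * L) + k * (2 * T) + 2 * L
    ≤⟨ +-mono-≤ (+-mono-≤ (+-monoʳ-≤ (2 * S) (*-monoʳ-≤ 2 excess)) (*-monoʳ-≤ k (*-monoʳ-≤ 2 T≤S)))
                (*-monoʳ-≤ 2 (<⇒≤ L<P)) ⟩
  2 * S + 2 * S + k * (2 * S) + 2 * P        ≡⟨ collect S P k ⟩
  suc (suc k) * (2 * S) + 2 * P              <⟨ +-monoˡ-< (2 * P) (*-monoʳ-< (suc (suc k)) hyp) ⟩
  suc (suc k) * (e * P) + 2 * P              ≤⟨ +-mono-≤ (*-monoˡ-≤ (e * P) m<c) 2P≤ ⟩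
  c * (e * P) + suc k * (P * c)              ≡⟨ distribute c e P k ⟩
  (e + suc k) * (P * c)                      ∎
  where
  open ≤-Reasoning
  T≤S : T ≤ S
  T≤S = ≤-trans (m≤m+n T (e * L)) excess
  L<P : L < P
  L<P = *-cancelˡ-< e L P (≤-<-trans (≤-trans (m≤n+m (e * L) T) excess) (≤-<-trans (m≤m+n S (S + 0)) hyp))
  2P≤ : 2 * P ≤ suc k * (P * c)
  2P≤ = ≤-trans (≤-reflexive (*-comm 2 P)) (≤-trans (*-monoʳ-≤ P (≤-trans (s≤s (s≤s z≤n)) m<c)) (m≤m+n (P * c) _))
  regroup : ∀ S T L k e → 2 * (S + suc k * T + suc e * L) ≡ 2 * S + 2 * (T + e * L) + k * (2 * T) + 2 * L
  regroup = solve-∀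
  collect : ∀ S P k → 2 * S + 2 * S + k * (2 * S) + 2 * P ≡ suc (suc k) * (2 * S) + 2 * P
  collect = solve-∀
  distribute : ∀ c e P k → c * (e * P) + suc k * (P * c) ≡ (e + suc k) * (P * c)
  distribute = solve-∀

module Components {n M} (G : Graph n) (x : Fin n) (V : Fin M → Subset n)
                  (components : IsComponentsOfDeletion G x V) where

  private
    x∉V : ∀ i → x ∉ V i
    x∉V = proj₁ components

    covered : ∀ v → v ≢ x → ∃ λ i → v ∈ V i
    covered = proj₁ (proj₂ components)

    V-disjoint : ∀ i j v → v ∈ V i → v ∈ V j → i ≡ j
    V-disjoint = proj₁ (proj₂ (proj₂ components))

    V-connected : ∀ i → ConnectedSet G (V i)
    V-connected = proj₁ (proj₂ (proj₂ (proj₂ components)))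

    V-closed : ∀ i j u v → u ∈ V i → v ∈ V j → Adj G u v → i ≡ j
    V-closed = proj₂ (proj₂ (proj₂ (proj₂ components)))

    V#V : ∀ {i j} → i ≢ j → Disjoint (V i) (V j)
    V#V i≢j v∈Vi v∈Vj = i≢j (V-disjoint _ _ _ v∈Vi v∈Vj)

    x∉V∪V : ∀ i j → x ∉ V i ∪ V j
    x∉V∪V i j x∈ with x∈p∪q⁻ (V i) (V j) x∈
    ... | inj₁ x∈Vi = x∉V i x∈Vi
    ... | inj₂ x∈Vj = x∉V j x∈Vj

  ∣Vi∣+∣Vj∣<n : ∀ {i j} → i ≢ j → ∣ V i ∣ + ∣ V j ∣ < n
  ∣Vi∣+∣Vj∣<n {i} {j} i≢j =
    subst (_< n) (∣p∪q∣≡∣p∣+∣q∣ (V i) (V j) (V#V i≢j)) (x∉p⇒∣p∣<n (x∉V∪V i j))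

  ∣Vi∣+∣Vj∣+∣Vk∣<n : ∀ {i j k} → i ≢ j → i ≢ k → j ≢ k → ∣ V i ∣ + (∣ V j ∣ + ∣ V k ∣) < n
  ∣Vi∣+∣Vj∣+∣Vk∣<n {i} {j} {k} i≢j i≢k j≢k = subst (_< n) size (x∉p⇒∣p∣<n x∉Vi∪Vj∪Vk)
    where
    size : ∣ V i ∪ V j ∪ V k ∣ ≡ ∣ V i ∣ + (∣ V j ∣ + ∣ V k ∣)
    size = trans (∣p∪q∣≡∣p∣+∣q∣ (V i) (V j ∪ V k) (Disjoint-∪ʳ (V j) (V k) (V#V i≢j) (V#V i≢k)))
                 (cong (∣ V i ∣ +_) (∣p∪q∣≡∣p∣+∣q∣ (V j) (V k) (V#V j≢k)))
    x∉Vi∪Vj∪Vk : x ∉ V i ∪ V j ∪ V k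
    x∉Vi∪Vj∪Vk x∈ with x∈p∪q⁻ (V i) (V j ∪ V k) x∈
    ... | inj₁ x∈Vi   = x∉V i x∈Vi
    ... | inj₂ x∈Vj∪Vk = x∉V∪V j k x∈Vj∪Vk

  0<∣Vi∣ : ∀ i → 0 < ∣ V i ∣
  0<∣Vi∣ i = Nonempty⇒0<∣p∣ (proj₁ (V-connected i))

  neighbour : IsConnectedGraph G → ∀ i → ∃ λ y → y ∈ V i × Adj G y x
  neighbour connected i with proj₁ (V-connected i)
  ... | v , v∈Vi with Walk-exit G (connected v x ∈⊤ ∈⊤) v∈Vi (x∉V i)
  ... | u , w , u∈Vi , w∉Vi , _ , u~w with w ≟ x
  ... | yes refl = u , u∈Vi , u~w
  ... | no  w≢x with covered w w≢x
  ... | j , w∈Vj = contradiction (subst (λ l → w ∈ V l) (sym (V-closed i j u w u∈Vi w∈Vj u~w)) w∈Vj) w∉Vi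

  1+∣Vi∣≤#connectedSetsThrough-x : ∀ {k} → IsConnectedGraph G → ∀ i →
    HasSize (ConnectedSetThrough G x (V i ∪ ⁅ x ⁆)) k → suc ∣ V i ∣ ≤ k
  1+∣Vi∣≤#connectedSetsThrough-x connected i count =
    let y , y∈Vi , y~x = neighbour connected i in
    subst (_≤ _) ∣Vi∪⁅x⁆∣≡1+∣Vi∣
      (∣S∣≤#connectedSetsThrough G (connected-∪-neighbour G (proj₂ (V-connected i)) y∈Vi y~x)
                                   (q⊆p∪q (V i) ⁅ x ⁆ (x∈⁅x⁆ x)) count)
    where
    ∣Vi∪⁅x⁆∣≡1+∣Vi∣ : ∣ V i ∪ ⁅ x ⁆ ∣ ≡ suc ∣ V i ∣
    ∣Vi∪⁅x⁆∣≡1+∣Vi∣ = begin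
      ∣ V i ∪ ⁅ x ⁆ ∣     ≡⟨ ∣p∪q∣≡∣p∣+∣q∣ (V i) ⁅ x ⁆ (x∉p⇒Disjoint[p,⁅x⁆] (x∉V i)) ⟩
      ∣ V i ∣ + ∣ ⁅ x ⁆ ∣ ≡⟨ cong (∣ V i ∣ +_) (∣⁅x⁆∣≡1 x) ⟩
      ∣ V i ∣ + 1         ≡⟨ +-comm ∣ V i ∣ 1 ⟩
      suc ∣ V i ∣         ∎
      where open ≡-Reasoning

-- The counts N i are only used through the minimality of N (fromℕ K); what they count is irrelevant.
lemma6p6 : ∀ {n K : ℕ} (G : Graph n) (x : Fin n) (V : Fin (suc K) → Subset n)
    (N Nx : Fin (suc K) → ℕ) →
    IsConnectedGraph G →
    2 ≤ K →
    IsComponentsOfDeletion G x V →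
    (∀ i → HasSize (λ S → ConnectedSet G S × S ⊆ V i) (N i)) →
    (∀ i → HasSize (λ S → ConnectedSet G S × x ∈ S × S ⊆ (V i ∪ ⁅ x ⁆)) (Nx i)) →
    (∀ i → N (fromℕ K) ≤ N i) →
    let n′ = n ∸ ∣ V (fromℕ K) ∣ in
    2 * ∑ K (λ i → (n′ ∸ ∣ V (inject₁ i) ∣) * N (inject₁ i))
      < (n′ ∸ 1) * ∏ K (λ i → Nx (inject₁ i)) →
    2 * ∑ (suc K) (λ i → (n ∸ ∣ V i ∣) * N i) < (n ∸ 1) * ∏ (suc K) Nx
lemma6p6 {n} {suc (suc k)} G x V N Nx connected (s≤s (s≤s z≤n)) components _ Nx-count N-min hyp
  with n ∸ ∣ V (fromℕ (suc (suc k))) ∣ in n′≡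
... | zero  = contradiction hyp n≮0
... | suc e = begin-strict
  2 * ∑ (suc K) (λ i → (n ∸ ∣ V i ∣) * N i) ≡⟨ cong (2 *_) (∑-last K (λ i → (n ∸ ∣ V i ∣) * N i)) ⟩
  2 * (D + (n ∸ m) * N M)                   ≡⟨ cong (λ n′ → 2 * (D + n′ * N M)) n′≡ ⟩
  2 * (D + suc e * N M)                     <⟨ add-component-inequality e m excess hyp D≤ (0<∣Vi∣ M) Nx-bound ⟩
  (e + m) * (P * Nx M)                      ≡⟨ cong (_* (P * Nx M)) n∸1≡e+m ⟨
  (n ∸ 1) * (P * Nx M)                      ≡⟨ cong ((n ∸ 1) *_) (∏-last K Nx) ⟨
  (n ∸ 1) * ∏ (suc K) Nx                    ∎
  where
  open ≤-Reasoning
  open Components G x V components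
  K : ℕ
  K = suc (suc k)
  M : Fin (suc K)
  M = fromℕ K
  m : ℕ
  m = ∣ V M ∣
  s : Fin K → ℕ
  s i = ∣ V (inject₁ i) ∣
  N′ : Fin K → ℕ
  N′ i = N (inject₁ i)
  D P : ℕ
  D = ∑ K (λ i → (n ∸ s i) * N′ i)
  P = ∏ K (λ i → Nx (inject₁ i))

  ≤e : ∀ {a} → a + m < n → a ≤ e
  ≤e {a} a+m<n = ≤-pred (subst (suc a ≤_) n′≡ (m+n≤o⇒m≤o∸n (suc a) a+m<n))

  ≢M : ∀ i → inject₁ i ≢ M
  ≢M i i≡M = fromℕ≢inject₁ (sym i≡M)

  excess : ∑ K N′ + e * N M ≤ ∑ K (λ i → (suc e ∸ s i) * N′ i)
  excess = ∑-excess k s N′ (λ i → ≤e (∣Vi∣+∣Vj∣<n (≢M i)))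
    (≤e (subst (_< n) (sym (+-assoc (s zero) (s (suc zero)) m))
                      (∣Vi∣+∣Vj∣+∣Vk∣<n (λ ()) (≢M zero) (≢M (suc zero)))))
    (λ i → N-min (inject₁ i))

  D≤ : D ≤ ∑ K (λ i → (suc e ∸ s i) * N′ i) + m * ∑ K N′
  D≤ = subst (λ n′ → D ≤ ∑ K (λ i → (n′ ∸ s i) * N′ i) + m * ∑ K N′) n′≡ (∑-weights-∸ K n m s N′)

  Nx-bound : suc m ≤ Nx M
  Nx-bound = 1+∣Vi∣≤#connectedSetsThrough-x connected M (Nx-count M)

  n∸1≡e+m : n ∸ 1 ≡ e + m
  n∸1≡e+m = cong (_∸ 1) (trans (sym (m∸n+n≡m (∣p∣≤n (V M)))) (cong (_+ m) n′≡))
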